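{- Let $W_1$ be the graph with vertex set $\{a,b,c,d,a',b',c',d'\}$ and edges $ab,bd,dc,ca,aa',a'c',c'c,a'b',b'd',d'c',bd',db'$, and let $W_2$ be the graph with vertex set $\{a,b,c,u,v,w,x,y\}$ and edges $ab,bc,ca,au,ux,xw,wy,yv,vb,uy,vx,cw$. For each $i\in\{1,2\}$ and every signature $\sigma$ of $W_i$, $F(W_i,\sigma)\le\tfrac13 v(W_i)$.
   Context: A signature of a graph $G$ is a map $\sigma:E(G)\to\{+,-\}$; $E^-_{(G,\sigma)}$ denotes the negative edges. Switching at an edge cut changes the sign of every edge of the cut; two signatures are switching equivalent if one arises from the other by switching at some cut. The frustration index is $F(G,\sigma)=\min|E^-_{(G,\sigma')}|$ over $\sigma'$ switching equivalent to $\sigma$. $v(G)$ is the number of vertices. -}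

module Defs where

open import Data.Nat using (ℕ; zero; suc; _+_; _⊓_)
open import Data.Bool using (Bool; true; false; _xor_; if_then_else_)
open import Data.Fin using (Fin; zero; suc)
open import Data.Vec using (Vec; []; _∷_; lookup; allFin)
open import Data.List using (List; []; _∷_; map; _++_; foldr)
open import Data.Product using (_×_; _,_; proj₁; proj₂)

record Graph : Set where
  constructor mkGraph
  field
    nv    : ℕ
    ne    : ℕ
    ends  : Vec (Fin nv × Fin nv) ne

open Graph public

v : Graph → ℕ
v G = nv G

data Sign : Set where
  ⊕ ⊖ : Sign

flip : Sign → Sign
flip ⊕ = ⊖
flip ⊖ = ⊕

Signature : Graph → Set
Signature G = Fin (ne G) → Sign

VSubset : Graph → Set
VSubset G = Fin (nv G) → Bool

inCut : (G : Graph) → VSubset G → Fin (ne G) → Bool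
inCut G X e = X (proj₁ (lookup (ends G) e)) xor X (proj₂ (lookup (ends G) e))

switch : (G : Graph) → VSubset G → Signature G → Signature G
switch G X σ e = if inCut G X e then flip (σ e) else σ e

countNeg : (m : ℕ) → (Fin m → Sign) → ℕ
countNeg zero    σ = 0
countNeg (suc m) σ = neg (σ zero) + countNeg m (λ i → σ (suc i))
  where
  neg : Sign → ℕ
  neg ⊕ = 0
  neg ⊖ = 1

numNeg : (G : Graph) → Signature G → ℕ
numNeg G σ = countNeg (ne G) σ

allSubsets : (n : ℕ) → List (Fin n → Bool)
allSubsets zero    = (λ ()) ∷ []
allSubsets (suc n) =
  map (λ X → λ { zero → false ; (suc i) → X i }) (allSubsets n) ++
  map (λ X → λ { zero → true  ; (suc i) → X i }) (allSubsets n)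

-- Every edge cut is δ(X) for some X ⊆ V(G), so the signatures switching
-- equivalent to σ are exactly { switch G X σ | X ⊆ V(G) }.
F : (G : Graph) → Signature G → ℕ
F G σ = foldr (λ X r → numNeg G (switch G X σ) ⊓ r)
              (numNeg G σ)
              (allSubsets (nv G))

W₁ : Graph
W₁ = mkGraph 8 12
  ( (a , b) ∷ (b , d) ∷ (d , c) ∷ (c , a) ∷ (a , a') ∷ (a' , c') ∷
    (c' , c) ∷ (a' , b') ∷ (b' , d') ∷ (d' , c') ∷ (b , d') ∷ (d , b') ∷ [])
  where
  a b c d a' b' c' d' : Fin 8
  a = zero
  b = suc zero
  c = suc (suc zero)
  d = suc (suc (suc zero))
  a' = suc (suc (suc (suc zero)))
  b' = suc (suc (suc (suc (suc zero))))
  c' = suc (suc (suc (suc (suc (suc zero)))))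
  d' = suc (suc (suc (suc (suc (suc (suc zero))))))

W₂ : Graph
W₂ = mkGraph 8 12
  ( (a , b) ∷ (b , c) ∷ (c , a) ∷ (a , u) ∷ (u , x) ∷ (x , w) ∷
    (w , y) ∷ (y , v₀) ∷ (v₀ , b) ∷ (u , y) ∷ (v₀ , x) ∷ (c , w) ∷ [])
  where
  a b c u v₀ w x y : Fin 8
  a = zero
  b = suc zero
  c = suc (suc zero)
  u = suc (suc (suc zero))
  v₀ = suc (suc (suc (suc zero)))
  w = suc (suc (suc (suc (suc zero))))
  x = suc (suc (suc (suc (suc (suc zero)))))
  y = suc (suc (suc (suc (suc (suc (suc zero))))))

W : Fin 2 → Graph
W zero       = W₁
W (suc zero) = W₂

-- Switching at the potential obtained by summing edge signs along root paths of a
-- spanning tree makes every tree edge positive.  Since the frustration index is a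
-- switching invariant, it is determined by the 2^(m - n + 1) = 32 signatures of W_i
-- that are positive on a fixed spanning tree, and for each of them a direct
-- computation gives F ≤ 2, hence 3 F ≤ 6 ≤ 8 = v(W_i).
module Submission where

open import Defs
open import Algebra.Bundles using (CommutativeRing)
open import Data.Bool using (Bool; true; false; _xor_; if_then_else_)
open import Data.Bool.Properties using (xor-∧-commutativeRing)
open import Data.Fin using (Fin; zero; suc; #_) renaming (_≟_ to _≟ᶠ_)
open import Data.List using (List; []; _∷_; foldr; cartesianProductWith)
open import Data.List.Membership.Propositional using (_∈_)
open import Data.List.Membership.Propositional.Properties
  using (∈-map⁺; ∈-++⁺ˡ; ∈-++⁺ʳ; ∈-cartesianProductWith⁺)
open import Data.List.Properties using (≡-dec)
open import Data.List.Relation.Unary.All using (All; all?) renaming (lookup to All-lookup)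
open import Data.List.Relation.Unary.Any using (here; there)
open import Data.Nat using (ℕ; zero; suc; _*_; _≤_; _⊓_; _≤?_)
open import Data.Nat.Properties
  using (≤-trans; ≤-reflexive; m≤m+n; m⊓n≤m; m⊓n≤n; ⊓-sel; *-monoʳ-≤; module ≤-Reasoning)
open import Data.Product using (_×_; _,_; ∃-syntax; proj₁; proj₂)
open import Data.Sum using (_⊎_; inj₁; inj₂)
open import Data.Vec using ([]; _∷_; lookup)
open import Data.Vec.Functional using () renaming (_∷_ to _◂_)
open import Function using (_∘_)
open import Relation.Binary.PropositionalEquality
  using (_≡_; _≗_; refl; sym; trans; cong; cong₂; module ≡-Reasoning)
open import Relation.Nullary.Decidable using (Dec; yes; no; toWitness)

open import Algebra.Properties.CommutativeSemigroup
  (CommutativeRing.+-commutativeSemigroup xor-∧-commutativeRing) using (interchange)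

allSubsets-complete : ∀ n (X : Fin n → Bool) → ∃[ Y ] Y ∈ allSubsets n × X ≗ Y
allSubsets-complete zero X = (λ ()) , here refl , λ ()
allSubsets-complete (suc n) X with allSubsets-complete n (X ∘ suc) | X zero in X₀
... | Y , Y∈ , X≗Y | false = _ , ∈-++⁺ˡ (∈-map⁺ _ Y∈) , λ { zero → X₀ ; (suc i) → X≗Y i }
... | Y , Y∈ , X≗Y | true  = _ , ∈-++⁺ʳ _ (∈-map⁺ _ Y∈) , λ { zero → X₀ ; (suc i) → X≗Y i }

choiceFunctions : {A : Set} (n : ℕ) → (Fin n → List A) → List (Fin n → A)
choiceFunctions zero    choices = (λ ()) ∷ []
choiceFunctions (suc n) choices =
  cartesianProductWith _◂_ (choices zero) (choiceFunctions n (choices ∘ suc))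

choiceFunctions-complete : {A : Set} (n : ℕ) (choices : Fin n → List A) (f : Fin n → A) →
                           (∀ i → f i ∈ choices i) → ∃[ g ] g ∈ choiceFunctions n choices × f ≗ g
choiceFunctions-complete zero    choices f f∈ = (λ ()) , here refl , λ ()
choiceFunctions-complete (suc n) choices f f∈
  with choiceFunctions-complete n (choices ∘ suc) (f ∘ suc) (f∈ ∘ suc)
... | g , g∈ , f≗g =
  f zero ◂ g , ∈-cartesianProductWith⁺ _◂_ (f∈ zero) g∈ , λ { zero → refl ; (suc i) → f≗g i }

module _ {A : Set} (f : A → ℕ) (b : ℕ) where

  minimum : List A → ℕ
  minimum = foldr (λ x r → f x ⊓ r) b

  minimum-≤ : ∀ {x xs} → x ∈ xs → minimum xs ≤ f x
  minimum-≤ {xs = y ∷ ys} (here refl) = m⊓n≤m (f y) (minimum ys)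
  minimum-≤ {xs = y ∷ ys} (there x∈) = ≤-trans (m⊓n≤n (f y) (minimum ys)) (minimum-≤ x∈)

  minimum-attained : ∀ xs → minimum xs ≡ b ⊎ ∃[ x ] x ∈ xs × minimum xs ≡ f x
  minimum-attained []       = inj₁ refl
  minimum-attained (y ∷ ys) with ⊓-sel (f y) (minimum ys) | minimum-attained ys
  ... | inj₁ eq | _                   = inj₂ (y , here refl , eq)
  ... | inj₂ eq | inj₁ eq′            = inj₁ (trans eq eq′)
  ... | inj₂ eq | inj₂ (x , x∈ , eq′) = inj₂ (x , there x∈ , trans eq eq′)

isNegative : Sign → Bool
isNegative ⊕ = false
isNegative ⊖ = true

flipIf : Bool → Sign → Sign
flipIf b s = if b then flip s else s

flip-involutive : ∀ s → flip (flip s) ≡ s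
flip-involutive ⊕ = refl
flip-involutive ⊖ = refl

flipIf-xor : ∀ a b s → flipIf a (flipIf b s) ≡ flipIf (a xor b) s
flipIf-xor false b     s = refl
flipIf-xor true  false s = refl
flipIf-xor true  true  s = flip-involutive s

flipIf-isNegative : ∀ s → flipIf (isNegative s) s ≡ ⊕
flipIf-isNegative ⊕ = refl
flipIf-isNegative ⊖ = refl

xor-cancelˡ : ∀ x y → x xor (y xor x) ≡ y
xor-cancelˡ false false = refl
xor-cancelˡ false true  = refl
xor-cancelˡ true  false = refl
xor-cancelˡ true  true  = refl

parity : ∀ {m} → (Fin m → Sign) → List (Fin m) → Bool
parity σ = foldr (λ e b → isNegative (σ e) xor b) false

source target : (G : Graph) → Fin (ne G) → Fin (nv G)
source G e = proj₁ (lookup (ends G) e)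
target G e = proj₂ (lookup (ends G) e)

countNeg-cong : ∀ m {σ τ : Fin m → Sign} → σ ≗ τ → countNeg m σ ≡ countNeg m τ
-- The local `neg` of countNeg also takes the signature as an argument, so congruence
-- only applies once the first sign is split.
countNeg-cong zero    σ≗τ = refl
countNeg-cong (suc m) {σ} {τ} σ≗τ with σ zero | τ zero | σ≗τ zero
... | ⊕ | ⊕ | refl = countNeg-cong m {σ ∘ suc} {τ ∘ suc} (σ≗τ ∘ suc)
... | ⊖ | ⊖ | refl = cong suc (countNeg-cong m {σ ∘ suc} {τ ∘ suc} (σ≗τ ∘ suc))

switch-cong : ∀ G {X Y : VSubset G} {σ τ : Signature G} →
              X ≗ Y → σ ≗ τ → switch G X σ ≗ switch G Y τ
switch-cong G X≗Y σ≗τ e = cong₂ flipIf (cong₂ _xor_ (X≗Y (source G e)) (X≗Y (target G e))) (σ≗τ e)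

switch-switch : ∀ G X Y σ → switch G X (switch G Y σ) ≗ switch G (λ v → X v xor Y v) σ
switch-switch G X Y σ e =
  trans (flipIf-xor (inCut G X e) (inCut G Y e) (σ e))
        (cong (λ b → flipIf b (σ e))
              (interchange (X (source G e)) (X (target G e)) (Y (source G e)) (Y (target G e))))

F≤numNeg-switch : ∀ G σ X → F G σ ≤ numNeg G (switch G X σ)
F≤numNeg-switch G σ X with allSubsets-complete (nv G) X
... | Y , Y∈ , X≗Y = ≤-trans (minimum-≤ (λ Z → numNeg G (switch G Z σ)) (numNeg G σ) Y∈)
                             (≤-reflexive (countNeg-cong (ne G) (switch-cong G (sym ∘ X≗Y) (λ _ → refl))))

F-attained : ∀ G σ → ∃[ X ] F G σ ≡ numNeg G (switch G X σ)
F-attained G σ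
  with minimum-attained (λ X → numNeg G (switch G X σ)) (numNeg G σ) (allSubsets (nv G))
... | inj₁ F≡            = (λ _ → false) , F≡
... | inj₂ (X , _ , F≡) = X , F≡

F≤F-switch : ∀ G {σ τ} X → τ ≗ switch G X σ → F G σ ≤ F G τ
F≤F-switch G {σ} {τ} X τ≗ with F-attained G τ
... | Y , Fτ≡ = begin
    F G σ                                      ≤⟨ F≤numNeg-switch G σ (λ v → Y v xor X v) ⟩
    numNeg G (switch G (λ v → Y v xor X v) σ)  ≡⟨ countNeg-cong (ne G) switched≗ ⟩
    numNeg G (switch G Y τ)                    ≡⟨ sym Fτ≡ ⟩
    F G τ                                      ∎
  where
  open ≤-Reasoning
  switched≗ : switch G (λ v → Y v xor X v) σ ≗ switch G Y τ
  switched≗ e = sym (trans (switch-cong G {Y} (λ _ → refl) τ≗ e) (switch-switch G Y X σ e))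

module RootPaths (G : Graph) (path : Fin (nv G) → List (Fin (ne G))) where

  potential : Signature G → VSubset G
  potential σ = parity σ ∘ path

  IsTreeEdge : Fin (ne G) → Set
  IsTreeEdge e = path (target G e) ≡ e ∷ path (source G e)

  treeEdge? : ∀ e → Dec (IsTreeEdge e)
  treeEdge? e = ≡-dec _≟ᶠ_ (path (target G e)) (e ∷ path (source G e))

  switch-potential-treeEdge : ∀ σ {e} → IsTreeEdge e → switch G (potential σ) σ e ≡ ⊕
  switch-potential-treeEdge σ {e} tree = begin
      flipIf (p u xor p (target G e)) (σ e)
    ≡⟨ cong (λ es → flipIf (p u xor parity σ es) (σ e)) tree ⟩
      flipIf (p u xor (isNegative (σ e) xor p u)) (σ e)
    ≡⟨ cong (λ b → flipIf b (σ e)) (xor-cancelˡ (p u) (isNegative (σ e))) ⟩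
      flipIf (isNegative (σ e)) (σ e)
    ≡⟨ flipIf-isNegative (σ e) ⟩
      ⊕
    ∎
    where
    open ≡-Reasoning
    p : VSubset G
    p = potential σ
    u : Fin (nv G)
    u = source G e

  signChoices : Fin (ne G) → List Sign
  signChoices e with treeEdge? e
  ... | yes _ = ⊕ ∷ []
  ... | no  _ = ⊕ ∷ ⊖ ∷ []

  treePositiveSignatures : List (Signature G)
  treePositiveSignatures = choiceFunctions (ne G) signChoices

  switch-potential-∈-signChoices : ∀ σ e → switch G (potential σ) σ e ∈ signChoices e
  switch-potential-∈-signChoices σ e with treeEdge? e | switch G (potential σ) σ e in s
  ... | yes tree | _ = here (trans (sym s) (switch-potential-treeEdge σ tree))
  ... | no _     | ⊕ = here refl
  ... | no _     | ⊖ = there (here refl)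

  F≤-from-treePositive : ∀ k → All (λ τ → F G τ ≤ k) treePositiveSignatures → ∀ σ → F G σ ≤ k
  F≤-from-treePositive k bound σ
    with choiceFunctions-complete (ne G) signChoices _ (switch-potential-∈-signChoices σ)
  ... | τ , τ∈ , switched≗τ =
    ≤-trans (F≤F-switch G (potential σ) (sym ∘ switched≗τ)) (All-lookup bound τ∈)

-- The root is a; the path of a vertex lists the edges (by index in W_i) from it back to a.
W₁-rootPaths : Fin 8 → List (Fin 12)
W₁-rootPaths = lookup
  ( [] ∷ (# 0 ∷ []) ∷ (# 2 ∷ # 1 ∷ # 0 ∷ []) ∷ (# 1 ∷ # 0 ∷ []) ∷
    (# 4 ∷ []) ∷ (# 7 ∷ # 4 ∷ []) ∷ (# 5 ∷ # 4 ∷ []) ∷ (# 10 ∷ # 0 ∷ []) ∷ [])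

W₂-rootPaths : Fin 8 → List (Fin 12)
W₂-rootPaths = lookup
  ( [] ∷ (# 0 ∷ []) ∷ (# 1 ∷ # 0 ∷ []) ∷ (# 3 ∷ []) ∷
    (# 7 ∷ # 6 ∷ # 5 ∷ # 4 ∷ # 3 ∷ []) ∷ (# 5 ∷ # 4 ∷ # 3 ∷ []) ∷ (# 4 ∷ # 3 ∷ []) ∷
    (# 6 ∷ # 5 ∷ # 4 ∷ # 3 ∷ []) ∷ [])

W₁-F≤2 : ∀ σ → F W₁ σ ≤ 2
W₁-F≤2 = RootPaths.F≤-from-treePositive W₁ W₁-rootPaths 2
  (toWitness {a? = all? (λ τ → F W₁ τ ≤? 2) _} _)

W₂-F≤2 : ∀ σ → F W₂ σ ≤ 2
W₂-F≤2 = RootPaths.F≤-from-treePositive W₂ W₂-rootPaths 2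
  (toWitness {a? = all? (λ τ → F W₂ τ ≤? 2) _} _)

lemma3p2 : (i : Fin 2) (σ : Signature (W i)) → 3 * F (W i) σ ≤ v (W i)
lemma3p2 zero       σ = ≤-trans (*-monoʳ-≤ 3 (W₁-F≤2 σ)) (m≤m+n 6 2)
lemma3p2 (suc zero) σ = ≤-trans (*-monoʳ-≤ 3 (W₂-F≤2 σ)) (m≤m+n 6 2)
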